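{- Let $k$ be a positive integer, let $a,b$ be distinct nonnegative integers and $a_1,\dots,a_{k-1}$ positive integers. Then the multisets $f_{(a,b),(a_1,\ldots,a_{k-1})}$ and $f_{(b,a),(a_1,\ldots,a_{k-1})}$ on $\mathbb{Z}_2^{k-1}$ have distinguishing number $k$.
   Context: A multiset on $\mathbb{Z}_2^m$ is a function $\phi:\mathbb{Z}_2^m\to\mathbb{N}$. Its $i$-deck is $\mathrm{deck}_i\phi(s_1,\dots,s_i)=\sum_{g\in\mathbb{Z}_2^m}\phi(g+s_1)\cdots\phi(g+s_i)$ for $(s_1,\dots,s_i)\in(\mathbb{Z}_2^m)^i$. Two multisets are $k$-indistinguishable if their $i$-decks agree for all $i\le k$, and $k$-distinguishable otherwise; the distinguishing number of two multisets is the smallest $k$ for which they are $k$-distinguishable ($\infty$ if none). Identify elements of $\mathbb{Z}_2^{k-1}$ with vectors $x=(x_1,\dots,x_{k-1})$, $x_i\in\{0,1\}$. For nonnegative integers $a,b$ and positive integers $a_1,\dots,a_{k-1}$, $f_{(a,b),(a_1,\ldots,a_{k-1})}$ is the multiset on $\mathbb{Z}_2^{k-1}$ with $f(x)=a+\sum_i a_ix_i$ if $\sum_i x_i$ is even and $f(x)=b+\sum_i a_ix_i$ if $\sum_i x_i$ is odd (sums computed in the integers). -}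

module Defs where

open import Data.Bool using (Bool; true; false; if_then_else_; _xor_)
open import Data.Nat using (ℕ; zero; suc; _+_; _*_; _%_; _≤_; _<_)
open import Data.List using (List; []; _∷_; _++_; map)
open import Data.Nat.ListAction using (sum)
open import Data.Vec using (Vec; []; _∷_; zipWith; foldr; lookup; toList)
open import Data.Fin using (Fin)
open import Data.Product using (_×_)
open import Relation.Binary.PropositionalEquality using (_≡_)
open import Relation.Nullary using (¬_)

Z2^ : ℕ → Set
Z2^ m = Vec Bool m

_⊕_ : ∀ {m} → Z2^ m → Z2^ m → Z2^ m
_⊕_ = zipWith _xor_

elements : (m : ℕ) → List (Z2^ m)
elements zero = [] ∷ []
elements (suc m) = map (false ∷_) (elements m) ++ map (true ∷_) (elements m)

Multiset : ℕ → Set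
Multiset m = Z2^ m → ℕ

prodFin : (i : ℕ) → (Fin i → ℕ) → ℕ
prodFin zero h = 1
prodFin (suc i) h = h Fin.zero * prodFin i (λ j → h (Fin.suc j))

deck : ∀ {m} (i : ℕ) → Multiset m → (Fin i → Z2^ m) → ℕ
deck {m} i φ s = sum (map (λ g → prodFin i (λ j → φ (g ⊕ s j))) (elements m))

Indistinguishable : ∀ {m} → ℕ → Multiset m → Multiset m → Set
Indistinguishable k φ ψ = ∀ i → i ≤ k → ∀ s → deck i φ s ≡ deck i ψ s

Distinguishable : ∀ {m} → ℕ → Multiset m → Multiset m → Set
Distinguishable k φ ψ = ¬ Indistinguishable k φ ψ

HasDistinguishingNumber : ∀ {m} → Multiset m → Multiset m → ℕ → Set
HasDistinguishingNumber φ ψ k =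
  Distinguishable k φ ψ × (∀ j → j < k → ¬ Distinguishable j φ ψ)

weight : ∀ {n} → Vec Bool n → ℕ
weight = foldr _ (λ b r → (if b then 1 else 0) + r) 0

weightedSum : ∀ {n} → Vec ℕ n → Vec Bool n → ℕ
weightedSum cs x = foldr _ _+_ 0 (zipWith (λ c b → if b then c else 0) cs x)

parityChoice : ℕ → ℕ → ℕ → ℕ
parityChoice a b zero = a
parityChoice a b (suc _) = b

fMulti : ∀ {n} → ℕ → ℕ → Vec ℕ n → Multiset n
fMulti a b cs x = parityChoice a b (weight x % 2) + weightedSum cs x

-- Write f_{(a,b)}(x) = ℓ(x) + c(parity x) with ℓ affine over ℤ. Splitting the
-- sum in an i-deck by the parity of g shows that the difference of the i-decks
-- of f_{(a,b)} and f_{(b,a)} is Δ(Π F₀) − Δ(Π F₁), where Δ is the alternating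
-- sum over the cube ℤ₂^{k−1} and F₀, F₁ are families of i affine forms with the
-- same linear parts. Δ kills products of fewer than k−1 affine forms, so Δ of a
-- product of at most k−1 affine forms does not depend on their constant terms,
-- and the decks agree for i ≤ k−1. For i = k and s = 0 the difference is Δ over
-- ℤ₂^k of the k-th power of the affine form (b − a)y + a + Σ a_j x_j, which is
-- ±k! (b − a) a_1⋯a_{k−1} ≠ 0.
module Submission where

open import Defs
open import Data.Nat using (ℕ; _≤_; _∸_)
open import Data.Vec using (Vec; lookup)
open import Relation.Binary.PropositionalEquality using (_≢_)

open import Algebra.Bundles using (CommutativeRing)
import Algebra.Properties.CommutativeSemigroup as CommutativeSemigroupProperties
open import Data.Bool using (Bool; true; false; not; _xor_; if_then_else_)
open import Data.Bool.Properties using (xor-∧-commutativeRing)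
open import Data.Fin using (Fin; zero; suc)
open import Data.Integer using (ℤ; +_; 0ℤ; 1ℤ; _+_; _*_; -_; _-_)
import Data.Integer.Properties as ℤ
open import Data.Integer.Tactic.RingSolver using (solve-∀)
import Data.List as List
import Data.List.Properties as List
open import Data.Nat using (zero; suc; _<_; _%_; s≤s; z≤n)
import Data.Nat as ℕ
import Data.Nat.Properties as ℕ
open import Data.Nat.DivMod using (%-distribˡ-+)
open import Data.Nat.ListAction using (sum)
open import Data.Nat.ListAction.Properties using (sum-++)
open import Data.Product using (_,_)
open import Data.Sum using (inj₁; inj₂)
open import Data.Vec using ([]; _∷_; _++_; map; tabulate; replicate; head; tail)
import Data.Vec.Properties as Vec
open import Data.Vec.Relation.Binary.Pointwise.Inductive using (Pointwise; []; _∷_; tabulate⁺)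
open import Function using (_∘_)
open import Relation.Nullary using (¬_)
open import Relation.Binary.PropositionalEquality
  using (_≡_; refl; sym; trans; cong; cong₂; subst; module ≡-Reasoning)

open ≡-Reasoning

module ℤ+ = CommutativeSemigroupProperties ℤ.+-commutativeSemigroup
module ℤ* = CommutativeSemigroupProperties ℤ.*-commutativeSemigroup

private
  variable
    n m p q i : ℕ

record Affine (n : ℕ) : Set where
  constructor affine
  field
    constant : ℤ
    slope    : Vec ℤ n

open Affine

infixl 7 _·_
infixl 6 _+ᶜ_
infix 4 _∥_

_·_ : Vec ℤ n → Z2^ n → ℤ
[]      · []          = 0ℤ
(b ∷ β) · (false ∷ x) = β · x
(b ∷ β) · (true  ∷ x) = b + β · x

⟦_⟧ : Affine n → Z2^ n → ℤ
⟦ ℓ ⟧ x = constant ℓ + slope ℓ · x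

_+ᶜ_ : Affine n → ℤ → Affine n
ℓ +ᶜ d = affine (constant ℓ + d) (slope ℓ)

_∥_ : Affine n → Affine n → Set
ℓ ∥ ℓ′ = slope ℓ ≡ slope ℓ′

⟦+ᶜ⟧ : ∀ (ℓ : Affine n) d x → ⟦ ℓ +ᶜ d ⟧ x ≡ ⟦ ℓ ⟧ x + d
⟦+ᶜ⟧ ℓ d x = swap (constant ℓ) d (slope ℓ · x)
  where
  swap : ∀ c d l → (c + d) + l ≡ (c + l) + d
  swap = solve-∀

⟦⟧-∥ : ∀ {ℓ ℓ′ : Affine n} → ℓ ∥ ℓ′ → ∀ x → ⟦ ℓ′ ⟧ x ≡ ⟦ ℓ ⟧ x + (constant ℓ′ - constant ℓ)
⟦⟧-∥ {ℓ = affine c β} {affine c′ .β} refl x = shift c c′ (β · x)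
  where
  shift : ∀ c c′ l → c′ + l ≡ (c + l) + (c′ - c)
  shift = solve-∀

Π : Vec (Affine n) m → Z2^ n → ℤ
Π []      x = 1ℤ
Π (ℓ ∷ M) x = ⟦ ℓ ⟧ x * Π M x

Π-middle : ∀ (P : Vec (Affine n) p) ℓ (R : Vec (Affine n) m) x →
           Π (P ++ ℓ ∷ R) x ≡ ⟦ ℓ ⟧ x * Π (P ++ R) x
Π-middle []      ℓ R x = refl
Π-middle (e ∷ P) ℓ R x =
  trans (cong (⟦ e ⟧ x *_) (Π-middle P ℓ R x)) (ℤ*.x∙yz≈y∙xz (⟦ e ⟧ x) (⟦ ℓ ⟧ x) (Π (P ++ R) x))

Π-map-middle : ∀ {A : Set} (f : A → Affine n) (P : Vec A p) α (R : Vec A m) x →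
               Π (map f (P ++ α ∷ R)) x ≡ ⟦ f α ⟧ x * Π (map f (P ++ R)) x
Π-map-middle f P α R x = begin
  Π (map f (P ++ α ∷ R)) x             ≡⟨ cong (λ M → Π M x) (Vec.map-++ f P (α ∷ R)) ⟩
  Π (map f P ++ f α ∷ map f R) x       ≡⟨ Π-middle (map f P) (f α) (map f R) x ⟩
  ⟦ f α ⟧ x * Π (map f P ++ map f R) x ≡⟨ cong (λ M → ⟦ f α ⟧ x * Π M x) (Vec.map-++ f P R) ⟨
  ⟦ f α ⟧ x * Π (map f (P ++ R)) x     ∎

Π-replace-factor : ∀ {ℓ ℓ′ : Affine n} → ℓ ∥ ℓ′ → (P : Vec (Affine n) p) (R : Vec (Affine n) m) → ∀ x →
             Π (P ++ ℓ′ ∷ R) x ≡ Π (ℓ ∷ P ++ R) x + (constant ℓ′ - constant ℓ) * Π (P ++ R) x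
Π-replace-factor {ℓ = ℓ} {ℓ′} ℓ∥ℓ′ P R x = begin
  Π (P ++ ℓ′ ∷ R) x                                  ≡⟨ Π-middle P ℓ′ R x ⟩
  ⟦ ℓ′ ⟧ x * Π (P ++ R) x                            ≡⟨ cong (_* Π (P ++ R) x) (⟦⟧-∥ {ℓ = ℓ} {ℓ′} ℓ∥ℓ′ x) ⟩
  (⟦ ℓ ⟧ x + (constant ℓ′ - constant ℓ)) * Π (P ++ R) x ≡⟨ ℤ.*-distribʳ-+ (Π (P ++ R) x) (⟦ ℓ ⟧ x) _ ⟩
  Π (ℓ ∷ P ++ R) x + (constant ℓ′ - constant ℓ) * Π (P ++ R) x ∎

-- Δ n F = Σₓ (−1)^{x₁+⋯+xₙ} F x, the n-th mixed finite difference of F.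
Δ : ∀ n → (Z2^ n → ℤ) → ℤ
Δ zero    F = F []
Δ (suc n) F = Δ n (F ∘ (false ∷_)) - Δ n (F ∘ (true ∷_))

Δ-cong : ∀ {F G : Z2^ n → ℤ} → (∀ x → F x ≡ G x) → Δ n F ≡ Δ n G
Δ-cong {n = zero}  F≡G = F≡G []
Δ-cong {n = suc n} F≡G = cong₂ _-_ (Δ-cong (F≡G ∘ (false ∷_))) (Δ-cong (F≡G ∘ (true ∷_)))

Δ-linear : ∀ (F G : Z2^ n → ℤ) c → Δ n (λ x → F x + c * G x) ≡ Δ n F + c * Δ n G
Δ-linear {n = zero}  F G c = refl
Δ-linear {n = suc n} F G c = begin
  Δ n (λ x → F₀ x + c * G₀ x) - Δ n (λ x → F₁ x + c * G₁ x)
    ≡⟨ cong₂ _-_ (Δ-linear F₀ G₀ c) (Δ-linear F₁ G₁ c) ⟩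
  (Δ n F₀ + c * Δ n G₀) - (Δ n F₁ + c * Δ n G₁)
    ≡⟨ regroup (Δ n F₀) (Δ n G₀) (Δ n F₁) (Δ n G₁) c ⟩
  (Δ n F₀ - Δ n F₁) + c * (Δ n G₀ - Δ n G₁) ∎
  where
  F₀ = F ∘ (false ∷_)
  F₁ = F ∘ (true ∷_)
  G₀ = G ∘ (false ∷_)
  G₁ = G ∘ (true ∷_)
  regroup : ∀ f₀ g₀ f₁ g₁ c → (f₀ + c * g₀) - (f₁ + c * g₁) ≡ (f₀ - f₁) + c * (g₀ - g₁)
  regroup = solve-∀

restrict : Bool → Affine (suc n) → Affine n
restrict false ℓ = affine (constant ℓ) (tail (slope ℓ))
restrict true  ℓ = affine (constant ℓ + head (slope ℓ)) (tail (slope ℓ))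

⟦restrict⟧ : ∀ y (ℓ : Affine (suc n)) x → ⟦ restrict y ℓ ⟧ x ≡ ⟦ ℓ ⟧ (y ∷ x)
⟦restrict⟧ false (affine α (b ∷ β)) x = refl
⟦restrict⟧ true  (affine α (b ∷ β)) x = ℤ.+-assoc α b (β · x)

Π-restrict : ∀ y (M : Vec (Affine (suc n)) m) x → Π (map (restrict y) M) x ≡ Π M (y ∷ x)
Π-restrict y []      x = refl
Π-restrict y (ℓ ∷ M) x = cong₂ _*_ (⟦restrict⟧ y ℓ x) (Π-restrict y M x)

restrict-∥ : ∀ (M : Vec (Affine (suc n)) m) →
             Pointwise _∥_ (map (restrict false) M) (map (restrict true) M)
restrict-∥ []      = []
restrict-∥ (ℓ ∷ M) = refl ∷ restrict-∥ M

Δ-Π-step : ∀ (M : Vec (Affine (suc n)) m) →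
           Δ (suc n) (Π M) ≡ Δ n (Π (map (restrict false) M)) - Δ n (Π (map (restrict true) M))
Δ-Π-step M = sym (cong₂ _-_ (Δ-cong (Π-restrict false M)) (Δ-cong (Π-restrict true M)))

mutual
  Δ-Π-short : (M : Vec (Affine n) m) → m < n → Δ n (Π M) ≡ 0ℤ
  Δ-Π-short {n = suc n} M (s≤s m≤n) = begin
    Δ (suc n) (Π M)                                   ≡⟨ Δ-Π-step M ⟩
    Δ n (Π M₀) - Δ n (Π M₁)                           ≡⟨ cong (_- Δ n (Π M₁)) (Δ-Π-parallel [] (restrict-∥ M) m≤n) ⟩
    Δ n (Π M₁) - Δ n (Π M₁)                           ≡⟨ ℤ.+-inverseʳ (Δ n (Π M₁)) ⟩
    0ℤ                                                ∎
    where
    M₀ = map (restrict false) M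
    M₁ = map (restrict true) M

  Δ-Π-replace-factor : ∀ {ℓ ℓ′ : Affine n} → ℓ ∥ ℓ′ → (P : Vec (Affine n) p) (R : Vec (Affine n) m) →
                 p ℕ.+ m < n → Δ n (Π (P ++ ℓ′ ∷ R)) ≡ Δ n (Π (ℓ ∷ P ++ R))
  Δ-Π-replace-factor {n = n} {ℓ = ℓ} {ℓ′} ℓ∥ℓ′ P R p+m<n = begin
    Δ n (Π (P ++ ℓ′ ∷ R))                              ≡⟨ Δ-cong (Π-replace-factor {ℓ = ℓ} {ℓ′} ℓ∥ℓ′ P R) ⟩
    Δ n (λ x → Π (ℓ ∷ P ++ R) x + d * Π (P ++ R) x)    ≡⟨ Δ-linear (Π (ℓ ∷ P ++ R)) (Π (P ++ R)) d ⟩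
    Δ n (Π (ℓ ∷ P ++ R)) + d * Δ n (Π (P ++ R))        ≡⟨ cong (λ z → Δ n (Π (ℓ ∷ P ++ R)) + d * z) (Δ-Π-short (P ++ R) p+m<n) ⟩
    Δ n (Π (ℓ ∷ P ++ R)) + d * 0ℤ                      ≡⟨ drop (Δ n (Π (ℓ ∷ P ++ R))) d ⟩
    Δ n (Π (ℓ ∷ P ++ R))                               ∎
    where
    d = constant ℓ′ - constant ℓ
    drop : ∀ x d → x + d * 0ℤ ≡ x
    drop = solve-∀

  Δ-Π-parallel : (P : Vec (Affine n) p) {M M′ : Vec (Affine n) m} → Pointwise _∥_ M M′ →
                 p ℕ.+ m ≤ n → Δ n (Π (P ++ M)) ≡ Δ n (Π (P ++ M′))
  Δ-Π-parallel P [] _ = refl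
  Δ-Π-parallel {n = n} {p = p} {m = suc m} P {ℓ ∷ M} {ℓ′ ∷ M′} (ℓ∥ℓ′ ∷ M∥M′) p+1+m≤n = begin
    Δ n (Π (P ++ ℓ ∷ M))      ≡⟨ Δ-Π-replace-factor {ℓ = ℓ} {ℓ} refl P M p+m<n ⟩
    Δ n (Π (ℓ ∷ P ++ M))      ≡⟨ Δ-Π-parallel (ℓ ∷ P) M∥M′ p+m<n ⟩
    Δ n (Π (ℓ ∷ P ++ M′))     ≡⟨ Δ-Π-replace-factor {ℓ = ℓ} {ℓ′} ℓ∥ℓ′ P M′ p+m<n ⟨
    Δ n (Π (P ++ ℓ′ ∷ M′))    ∎
    where
    p+m<n : suc (p ℕ.+ m) ≤ n
    p+m<n = subst (_≤ n) (ℕ.+-suc p m) p+1+m≤n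

withSlope : Vec ℤ n → Vec ℤ m → Vec (Affine n) m
withSlope β = map (λ α → affine α β)

-- κ β = (−1)ⁿ n! β₁⋯βₙ, the value of Δ on a product of n affine forms of slope β.
κ : Vec ℤ n → ℤ
κ []                = 1ℤ
κ {suc n} (b ∷ β)   = - (+ suc n * b * κ β)

κ-nonzero : (β : Vec ℤ n) → (∀ j → lookup β j ≢ 0ℤ) → κ β ≢ 0ℤ
κ-nonzero [] _ ()
κ-nonzero {suc n} (b ∷ β) β≢0 κ≡0 with ℤ.i*j≡0⇒i≡0∨j≡0 (+ suc n * b) (ℤ.neg-injective κ≡0)
... | inj₂ κβ≡0 = κ-nonzero β (β≢0 ∘ suc) κβ≡0
... | inj₁ nb≡0 with ℤ.i*j≡0⇒i≡0∨j≡0 (+ suc n) nb≡0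
...   | inj₁ ()
...   | inj₂ b≡0 = β≢0 zero b≡0

-- The length of c is a separate index because Δ-Π-shift produces vectors of
-- length p + q, which is only propositionally equal to n.
mutual
  Δ-Π-withSlope : (β : Vec ℤ n) (c : Vec ℤ m) → m ≡ n → Δ n (Π (withSlope β c)) ≡ κ β
  Δ-Π-withSlope []      []  refl = refl
  Δ-Π-withSlope {n = suc n} (b ∷ β) c refl = begin
    Δ (suc n) (Π (withSlope (b ∷ β) c))
      ≡⟨ Δ-Π-step (withSlope (b ∷ β) c) ⟩
    Δ n (Π (map (restrict false) (withSlope (b ∷ β) c))) - Δ n (Π (map (restrict true) (withSlope (b ∷ β) c)))
      ≡⟨ cong₂ (λ M M′ → Δ n (Π M) - Δ n (Π M′))
               (sym (Vec.map-∘ (restrict false) _ c))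
               (trans (sym (Vec.map-∘ (restrict true) _ c)) (Vec.map-∘ _ (_+ b) c)) ⟩
    Δ n (Π (withSlope β c)) - Δ n (Π (withSlope β (map (_+ b) c)))
      ≡⟨ cong (λ z → Δ n (Π (withSlope β c)) - z) (Δ-Π-shift β b [] c refl) ⟩
    Δ n (Π (withSlope β c)) - (Δ n (Π (withSlope β c)) + + suc n * b * κ β)
      ≡⟨ cancel (Δ n (Π (withSlope β c))) (+ suc n * b * κ β) ⟩
    κ (b ∷ β) ∎
    where
    cancel : ∀ x y → x - (x + y) ≡ - y
    cancel = solve-∀

  Δ-Π-shift : (β : Vec ℤ n) (d : ℤ) (P : Vec ℤ p) (Q : Vec ℤ q) → p ℕ.+ q ≡ suc n →
              Δ n (Π (withSlope β (P ++ map (_+ d) Q))) ≡ Δ n (Π (withSlope β (P ++ Q))) + + q * d * κ β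
  Δ-Π-shift β d P [] _ = sym (add-zero _ d (κ β))
    where
    add-zero : ∀ x d k → x + + 0 * d * k ≡ x
    add-zero = solve-∀
  Δ-Π-shift {n = n} {p = p} {q = suc q} β d P (α ∷ Q) p+q≡n = begin
    Δ n (Π (withSlope β (P ++ (α + d) ∷ Qd)))
      ≡⟨ Δ-cong (λ x → trans (Π-map-middle _ P (α + d) Qd x)
                             (expand α d (β · x) (Π (withSlope β (P ++ Qd)) x))) ⟩
    Δ n (λ x → Π (withSlope β (α ∷ P ++ Qd)) x + d * Π (withSlope β (P ++ Qd)) x)
      ≡⟨ Δ-linear (Π (withSlope β (α ∷ P ++ Qd))) (Π (withSlope β (P ++ Qd))) d ⟩
    Δ n (Π (withSlope β (α ∷ P ++ Qd))) + d * Δ n (Π (withSlope β (P ++ Qd)))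
      ≡⟨ cong₂ (λ u v → u + d * v) (Δ-Π-shift β d (α ∷ P) Q p+q≡n′) (Δ-Π-withSlope β (P ++ Qd) p+q≡n″) ⟩
    (Δ n (Π (withSlope β (α ∷ P ++ Q))) + + q * d * κ β) + d * κ β
      ≡⟨ cong (λ u → (u + + q * d * κ β) + d * κ β) (Δ-cong {n = n} (λ x → sym (Π-map-middle (λ α → affine α β) P α Q x))) ⟩
    (Δ n (Π (withSlope β (P ++ α ∷ Q))) + + q * d * κ β) + d * κ β
      ≡⟨ collect (Δ n (Π (withSlope β (P ++ α ∷ Q)))) (+ q) d (κ β) ⟩
    Δ n (Π (withSlope β (P ++ α ∷ Q))) + (1ℤ + + q) * d * κ β
      ≡⟨ cong (λ r → Δ n (Π (withSlope β (P ++ α ∷ Q))) + r * d * κ β) (ℤ.pos-+ 1 q) ⟨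
    Δ n (Π (withSlope β (P ++ α ∷ Q))) + + suc q * d * κ β ∎
    where
    Qd = map (_+ d) Q
    p+q≡n′ : suc p ℕ.+ q ≡ suc n
    p+q≡n′ = trans (sym (ℕ.+-suc p q)) p+q≡n
    p+q≡n″ : p ℕ.+ q ≡ n
    p+q≡n″ = ℕ.suc-injective p+q≡n′
    expand : ∀ α d l r → ((α + d) + l) * r ≡ (α + l) * r + d * r
    expand = solve-∀
    collect : ∀ x m d k → (x + m * d * k) + d * k ≡ x + (1ℤ + m) * d * k
    collect = solve-∀

zeros : ∀ n → Z2^ n
zeros n = replicate n false

parity : Z2^ n → Bool
parity []       = false
parity (x ∷ xs) = x xor parity xs

parity-zeros : ∀ n → parity (zeros n) ≡ false
parity-zeros zero    = refl
parity-zeros (suc n) = parity-zeros n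

parity-⊕ : (g s : Z2^ n) → parity (g ⊕ s) ≡ parity g xor parity s
parity-⊕ []       []       = refl
parity-⊕ (g₀ ∷ g) (s₀ ∷ s) =
  trans (cong ((g₀ xor s₀) xor_) (parity-⊕ g s)) (interchange g₀ s₀ (parity g) (parity s))
  where
  open CommutativeSemigroupProperties (CommutativeRing.+-commutativeSemigroup xor-∧-commutativeRing)
    using (interchange)

weight%2 : (x : Z2^ n) → weight x % 2 ≡ (if parity x then 1 else 0)
weight%2 []         = refl
weight%2 (false ∷ x) = weight%2 x
weight%2 (true ∷ x)  = begin
  (1 ℕ.+ weight x) % 2              ≡⟨ %-distribˡ-+ 1 (weight x) 2 ⟩
  (1 ℕ.+ weight x % 2) % 2          ≡⟨ cong (λ r → (1 ℕ.+ r) % 2) (weight%2 x) ⟩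
  (1 ℕ.+ (if parity x then 1 else 0)) % 2 ≡⟨ flip (parity x) ⟩
  (if not (parity x) then 1 else 0) ∎
  where
  flip : ∀ p → (1 ℕ.+ (if p then 1 else 0)) % 2 ≡ (if not p then 1 else 0)
  flip false = refl
  flip true  = refl

choice : ℕ → ℕ → Bool → ℕ
choice a b p = if p then b else a

parityChoice-weight : ∀ a b (x : Z2^ n) → parityChoice a b (weight x % 2) ≡ choice a b (parity x)
parityChoice-weight a b x = trans (cong (parityChoice a b) (weight%2 x)) (by-cases (parity x))
  where
  by-cases : ∀ p → parityChoice a b (if p then 1 else 0) ≡ choice a b p
  by-cases false = refl
  by-cases true  = refl

translate : Affine n → Z2^ n → Affine n
translate ℓ []                           = ℓ
translate (affine α (b ∷ β)) (false ∷ s) = affine (constant ℓ′) (b ∷ slope ℓ′)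
  where ℓ′ = translate (affine α β) s
translate (affine α (b ∷ β)) (true ∷ s)  = affine (constant ℓ′ + b) (- b ∷ slope ℓ′)
  where ℓ′ = translate (affine α β) s

⟦translate⟧ : ∀ (ℓ : Affine n) (s g : Z2^ n) → ⟦ translate ℓ s ⟧ g ≡ ⟦ ℓ ⟧ (g ⊕ s)
⟦translate⟧ ℓ [] [] = refl
⟦translate⟧ (affine α (b ∷ β)) (y ∷ s) (x ∷ g) = by-cases y x
  where
  ℓ′ = translate (affine α β) s
  IH : constant ℓ′ + slope ℓ′ · g ≡ α + β · (g ⊕ s)
  IH = ⟦translate⟧ (affine α β) s g
  cancel : ∀ x y z → (x + y) + (- y + z) ≡ x + z
  cancel = solve-∀
  by-cases : ∀ y x → ⟦ translate (affine α (b ∷ β)) (y ∷ s) ⟧ (x ∷ g) ≡ α + (b ∷ β) · ((x xor y) ∷ (g ⊕ s))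
  by-cases false false = IH
  by-cases false true  = trans (ℤ+.x∙yz≈y∙xz (constant ℓ′) b (slope ℓ′ · g))
                               (trans (cong (λ z → b + z) IH) (ℤ+.x∙yz≈y∙xz b α (β · (g ⊕ s))))
  by-cases true  false = trans (ℤ+.xy∙z≈y∙xz (constant ℓ′) b (slope ℓ′ · g))
                               (trans (cong (λ z → b + z) IH) (ℤ+.x∙yz≈y∙xz b α (β · (g ⊕ s))))
  by-cases true  true  = trans (cancel (constant ℓ′) b (slope ℓ′ · g)) IH

slope-translate-zeros : ∀ (ℓ : Affine n) → slope (translate ℓ (zeros n)) ≡ slope ℓ
slope-translate-zeros {zero}  (affine α [])      = refl
slope-translate-zeros {suc n} (affine α (b ∷ β)) = cong (b ∷_) (slope-translate-zeros (affine α β))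

weightedSumForm : Vec ℕ n → Affine n
weightedSumForm cs = affine 0ℤ (map +_ cs)

weightedSum-⟦⟧ : ∀ (cs : Vec ℕ n) x → + weightedSum cs x ≡ ⟦ weightedSumForm cs ⟧ x
weightedSum-⟦⟧ []       []          = refl
weightedSum-⟦⟧ (c ∷ cs) (false ∷ x) = weightedSum-⟦⟧ cs x
weightedSum-⟦⟧ (c ∷ cs) (true ∷ x)  = begin
  + (c ℕ.+ weightedSum cs x)                ≡⟨ ℤ.pos-+ c (weightedSum cs x) ⟩
  + c + + weightedSum cs x                  ≡⟨ cong (λ z → + c + z) (weightedSum-⟦⟧ cs x) ⟩
  + c + (0ℤ + map +_ cs · x)                ≡⟨ ℤ+.x∙yz≈y∙xz (+ c) 0ℤ (map +_ cs · x) ⟩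
  0ℤ + (+ c + map +_ cs · x)                ∎

fMulti-⊕ : ∀ a b (cs : Vec ℕ n) (s g : Z2^ n) →
           + fMulti a b cs (g ⊕ s) ≡ ⟦ translate (weightedSumForm cs) s +ᶜ + choice a b (parity g xor parity s) ⟧ g
fMulti-⊕ a b cs s g = begin
  + (parityChoice a b (weight (g ⊕ s) % 2) ℕ.+ weightedSum cs (g ⊕ s))
    ≡⟨ ℤ.pos-+ _ (weightedSum cs (g ⊕ s)) ⟩
  + parityChoice a b (weight (g ⊕ s) % 2) + + weightedSum cs (g ⊕ s)
    ≡⟨ cong₂ _+_ (cong +_ (trans (parityChoice-weight a b (g ⊕ s)) (cong (choice a b) (parity-⊕ g s))))
                 (trans (weightedSum-⟦⟧ cs (g ⊕ s)) (sym (⟦translate⟧ (weightedSumForm cs) s g))) ⟩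
  + choice a b (parity g xor parity s) + ⟦ ℓ ⟧ g
    ≡⟨ ℤ.+-comm _ (⟦ ℓ ⟧ g) ⟩
  ⟦ ℓ ⟧ g + + choice a b (parity g xor parity s)
    ≡⟨ ⟦+ᶜ⟧ ℓ _ g ⟨
  ⟦ ℓ +ᶜ + choice a b (parity g xor parity s) ⟧ g ∎
  where
  ℓ = translate (weightedSumForm cs) s

∑ : ∀ n → (Z2^ n → ℤ) → ℤ
∑ zero    F = F []
∑ (suc n) F = ∑ n (F ∘ (false ∷_)) + ∑ n (F ∘ (true ∷_))

∑-cong : ∀ {F G : Z2^ n → ℤ} → (∀ x → F x ≡ G x) → ∑ n F ≡ ∑ n G
∑-cong {n = zero}  F≡G = F≡G []
∑-cong {n = suc n} F≡G = cong₂ _+_ (∑-cong (F≡G ∘ (false ∷_))) (∑-cong (F≡G ∘ (true ∷_)))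

sum-elements : ∀ n (h : Z2^ n → ℕ) → + sum (List.map h (elements n)) ≡ ∑ n (λ g → + h g)
sum-elements zero    h = cong +_ (ℕ.+-identityʳ (h []))
sum-elements (suc n) h = begin
  + sum (List.map h (List.map (false ∷_) E List.++ List.map (true ∷_) E))
    ≡⟨ cong (+_ ∘ sum) (List.map-++ h (List.map (false ∷_) E) _) ⟩
  + sum (List.map h (List.map (false ∷_) E) List.++ List.map h (List.map (true ∷_) E))
    ≡⟨ cong +_ (sum-++ (List.map h (List.map (false ∷_) E)) _) ⟩
  + (sum (List.map h (List.map (false ∷_) E)) ℕ.+ sum (List.map h (List.map (true ∷_) E)))
    ≡⟨ ℤ.pos-+ (sum (List.map h (List.map (false ∷_) E))) _ ⟩
  + sum (List.map h (List.map (false ∷_) E)) + + sum (List.map h (List.map (true ∷_) E))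
    ≡⟨ cong₂ _+_ (half false) (half true) ⟩
  ∑ (suc n) (λ g → + h g) ∎
  where
  E = elements n
  half : ∀ y → + sum (List.map h (List.map (y ∷_) E)) ≡ ∑ n (λ g → + h (y ∷ g))
  half y = trans (cong (+_ ∘ sum) (sym (List.map-∘ E))) (sum-elements n (h ∘ (y ∷_)))

∑-parity : ∀ n (H : Bool → Z2^ n → ℤ) →
           ∑ n (λ g → H (parity g) g) - ∑ n (λ g → H (not (parity g)) g) ≡ Δ n (H false) - Δ n (H true)
∑-parity zero    H = refl
∑-parity (suc n) H = begin
  (∑ n (same H₀) + ∑ n (same H₁)) - (∑ n (flipped H₀) + ∑ n (flipped H₁))
    ≡⟨ regroup (∑ n (same H₀)) (∑ n (same H₁)) (∑ n (flipped H₀)) (∑ n (flipped H₁)) ⟩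
  (∑ n (same H₀) - ∑ n (flipped H₀)) + (∑ n (same H₁) - ∑ n (flipped H₁))
    ≡⟨ cong₂ _+_ (∑-parity n H₀) (∑-parity n H₁) ⟩
  (Δ n (H₀ false) - Δ n (H₀ true)) + (Δ n (H₁ false) - Δ n (H₁ true))
    ≡⟨ regroup′ (Δ n (H₀ false)) (Δ n (H₀ true)) (Δ n (H₁ false)) (Δ n (H₁ true)) ⟩
  Δ (suc n) (H false) - Δ (suc n) (H true) ∎
  where
  H₀ H₁ : Bool → Z2^ n → ℤ
  H₀ q g = H q (false ∷ g)
  H₁ q g = H (not q) (true ∷ g)
  same flipped : (Bool → Z2^ n → ℤ) → Z2^ n → ℤ
  same    K g = K (parity g) g
  flipped K g = K (not (parity g)) g
  regroup : ∀ a b c d → (a + b) - (c + d) ≡ (a - c) + (b - d)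
  regroup = solve-∀
  regroup′ : ∀ a b c d → (a - b) + (c - d) ≡ (a - d) - (b - c)
  regroup′ = solve-∀

prodFin-Π : ∀ (h : Fin i → ℕ) (f : Fin i → Affine n) x →
            (∀ j → + h j ≡ ⟦ f j ⟧ x) → + prodFin i h ≡ Π (tabulate f) x
prodFin-Π {i = zero}  h f x h≡f = refl
prodFin-Π {i = suc i} h f x h≡f =
  trans (ℤ.pos-* (h zero) (prodFin i (h ∘ suc)))
        (cong₂ _*_ (h≡f zero) (prodFin-Π (h ∘ suc) (f ∘ suc) x (h≡f ∘ suc)))

Π-tabulate-cong : ∀ (f : Fin i → Affine m) (g : Fin i → Affine n) {x y} →
                  (∀ j → ⟦ f j ⟧ x ≡ ⟦ g j ⟧ y) → Π (tabulate f) x ≡ Π (tabulate g) y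
Π-tabulate-cong {i = zero}  f g f≡g = refl
Π-tabulate-cong {i = suc i} f g f≡g = cong₂ _*_ (f≡g zero) (Π-tabulate-cong (f ∘ suc) (g ∘ suc) (f≡g ∘ suc))

deckFactors : (Bool → ℕ) → Vec ℕ n → (Fin i → Z2^ n) → Bool → Vec (Affine n) i
deckFactors c cs s q = tabulate (λ j → translate (weightedSumForm cs) (s j) +ᶜ + c (q xor parity (s j)))

deck-fMulti : ∀ a b (cs : Vec ℕ n) (s : Fin i → Z2^ n) →
              + deck i (fMulti a b cs) s ≡ ∑ n (λ g → Π (deckFactors (choice a b) cs s (parity g)) g)
deck-fMulti {n = n} a b cs s =
  trans (sum-elements n _) (∑-cong (λ g → prodFin-Π _ _ g (λ j → fMulti-⊕ a b cs (s j) g)))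

choice-swap : ∀ a b q p → choice b a (q xor p) ≡ choice a b (not q xor p)
choice-swap a b false false = refl
choice-swap a b false true  = refl
choice-swap a b true  false = refl
choice-swap a b true  true  = refl

deckFactors-swap : ∀ a b (cs : Vec ℕ n) (s : Fin i → Z2^ n) q →
                   deckFactors (choice b a) cs s q ≡ deckFactors (choice a b) cs s (not q)
deckFactors-swap a b cs s q =
  Vec.tabulate-cong (λ j → cong (λ c → translate (weightedSumForm cs) (s j) +ᶜ + c) (choice-swap a b q (parity (s j))))

deck-difference : ∀ a b (cs : Vec ℕ n) (s : Fin i → Z2^ n) →
                  + deck i (fMulti a b cs) s - + deck i (fMulti b a cs) s
                    ≡ Δ n (Π (deckFactors (choice a b) cs s false)) - Δ n (Π (deckFactors (choice a b) cs s true))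
deck-difference {n = n} a b cs s = begin
  + deck _ (fMulti a b cs) s - + deck _ (fMulti b a cs) s
    ≡⟨ cong₂ _-_ (deck-fMulti a b cs s)
                 (trans (deck-fMulti b a cs s) (∑-cong (λ g → cong (λ M → Π M g) (deckFactors-swap a b cs s (parity g))))) ⟩
  ∑ n (λ g → Π (F (parity g)) g) - ∑ n (λ g → Π (F (not (parity g))) g)
    ≡⟨ ∑-parity n (λ q → Π (F q)) ⟩
  Δ n (Π (F false)) - Δ n (Π (F true)) ∎
  where
  F = deckFactors (choice a b) cs s

decks-agree : ∀ a b (cs : Vec ℕ n) → i ≤ n → (s : Fin i → Z2^ n) →
              deck i (fMulti a b cs) s ≡ deck i (fMulti b a cs) s
decks-agree {n = n} a b cs i≤n s = ℤ.+-injective (ℤ.i-j≡0⇒i≡j _ _ (begin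
  + deck _ (fMulti a b cs) s - + deck _ (fMulti b a cs) s ≡⟨ deck-difference a b cs s ⟩
  Δ n (Π (F false)) - Δ n (Π (F true))                    ≡⟨ cong (_- Δ n (Π (F true))) (Δ-Π-parallel [] (tabulate⁺ (λ _ → refl)) i≤n) ⟩
  Δ n (Π (F true)) - Δ n (Π (F true))                     ≡⟨ ℤ.+-inverseʳ (Δ n (Π (F true))) ⟩
  0ℤ                                                      ∎))
  where
  F = deckFactors (choice a b) cs s

-- μ is the affine form (b − a) y + ℓ₀ + a in one more variable y; fixing y = 0, 1
-- gives the factors of the two parity classes.
top-deck-difference : ∀ a b (cs : Vec ℕ n) →
                      + deck (suc n) (fMulti a b cs) (λ _ → zeros n) - + deck (suc n) (fMulti b a cs) (λ _ → zeros n)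
                        ≡ κ ((+ b - + a) ∷ map +_ cs)
top-deck-difference {n = n} a b cs = begin
  + deck (suc n) (fMulti a b cs) (λ _ → zeros n) - + deck (suc n) (fMulti b a cs) (λ _ → zeros n)
    ≡⟨ deck-difference {i = suc n} a b cs (λ _ → zeros n) ⟩
  Δ n (Π (F false)) - Δ n (Π (F true))
    ≡⟨ cong₂ _-_ (Δ-cong {n = n} (λ x → Π-tabulate-cong (F₀ false) μs {y = false ∷ x} (λ _ → at-false x)))
                 (Δ-cong {n = n} (λ x → Π-tabulate-cong (F₀ true) μs {y = true ∷ x} (λ _ → at-true x))) ⟩
  Δ (suc n) (Π (tabulate μs))
    ≡⟨ cong (λ M → Δ (suc n) (Π M)) (Vec.tabulate-∘ {n = suc n} (λ α → affine α (d ∷ β)) (λ _ → constant ℓ₀ + + a)) ⟩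
  Δ (suc n) (Π (withSlope (d ∷ β) c₀))
    ≡⟨ Δ-Π-withSlope (d ∷ β) c₀ refl ⟩
  κ (d ∷ β)
    ≡⟨ cong (λ β → κ (d ∷ β)) (slope-translate-zeros (weightedSumForm cs)) ⟩
  κ (d ∷ map +_ cs) ∎
  where
  ℓ₀ = translate (weightedSumForm cs) (zeros n)
  β  = slope ℓ₀
  d  = + b - + a
  μ  = affine (constant ℓ₀ + + a) (d ∷ β)
  μs : Fin (suc n) → Affine (suc n)
  μs _ = μ
  c₀ : Vec ℤ (suc n)
  c₀ = tabulate (λ _ → constant ℓ₀ + + a)
  F₀ : Bool → Fin (suc n) → Affine n
  F₀ q _ = ℓ₀ +ᶜ + choice a b (q xor parity (zeros n))
  F : Bool → Vec (Affine n) (suc n)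
  F q = tabulate (F₀ q)

  rebalance : ∀ c a b l → (c + b) + l ≡ (c + a) + ((b - a) + l)
  rebalance = solve-∀

  at-false : ∀ x → ⟦ F₀ false zero ⟧ x ≡ ⟦ μ ⟧ (false ∷ x)
  at-false x = cong (λ p → ⟦ ℓ₀ +ᶜ + choice a b p ⟧ x) (parity-zeros n)

  at-true : ∀ x → ⟦ F₀ true zero ⟧ x ≡ ⟦ μ ⟧ (true ∷ x)
  at-true x = trans (cong (λ p → ⟦ ℓ₀ +ᶜ + choice a b (not p) ⟧ x) (parity-zeros n))
                    (rebalance (constant ℓ₀) (+ a) (+ b) (β · x))

top-decks-differ : ∀ a b → a ≢ b → (cs : Vec ℕ n) → (∀ j → 1 ≤ lookup cs j) →
                   deck (suc n) (fMulti a b cs) (λ _ → zeros n) ≢ deck (suc n) (fMulti b a cs) (λ _ → zeros n)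
top-decks-differ {n = n} a b a≢b cs cs≥1 decks≡ = κ-nonzero ((+ b - + a) ∷ map +_ cs) entries≢0 (begin
  κ ((+ b - + a) ∷ map +_ cs)
    ≡⟨ top-deck-difference a b cs ⟨
  + deck (suc n) (fMulti a b cs) z - + deck (suc n) (fMulti b a cs) z
    ≡⟨ cong (λ D → + D - + deck (suc n) (fMulti b a cs) z) decks≡ ⟩
  + deck (suc n) (fMulti b a cs) z - + deck (suc n) (fMulti b a cs) z
    ≡⟨ ℤ.+-inverseʳ (+ deck (suc n) (fMulti b a cs) z) ⟩
  0ℤ ∎)
  where
  z : Fin (suc n) → Z2^ n
  z _ = zeros n
  entries≢0 : ∀ j → lookup ((+ b - + a) ∷ map +_ cs) j ≢ 0ℤ
  entries≢0 zero    b-a≡0 = a≢b (sym (ℤ.+-injective (ℤ.i-j≡0⇒i≡j (+ b) (+ a) b-a≡0)))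
  entries≢0 (suc j) csj≡0 =
    ℕ.<⇒≢ (cs≥1 j) (sym (ℤ.+-injective (trans (sym (Vec.lookup-map j +_ cs)) csj≡0)))

corollary4p2 : (k : ℕ) → 1 ≤ k → (a b : ℕ) → a ≢ b →
    (as : Vec ℕ (k ∸ 1)) → (∀ i → 1 ≤ lookup as i) →
    HasDistinguishingNumber (fMulti a b as) (fMulti b a as) k
corollary4p2 (suc n) (s≤s z≤n) a b a≢b as as≥1 = distinguishable , indistinguishable-below
  where
  distinguishable : Distinguishable (suc n) (fMulti a b as) (fMulti b a as)
  distinguishable decks≡ = top-decks-differ a b a≢b as as≥1 (decks≡ (suc n) ℕ.≤-refl (λ _ → zeros n))

  indistinguishable-below : ∀ j → j < suc n → ¬ Distinguishable j (fMulti a b as) (fMulti b a as)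
  indistinguishable-below j (s≤s j≤n) distinct =
    distinct (λ i i≤j → decks-agree a b as (ℕ.≤-trans i≤j j≤n))
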